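{- Let $\alpha$ be a finite sequence of positive integers of length $\ell$ and sum $S$, where $2\ell>S$. Then: (a) $\alpha$ contains at least $2\ell-S$ terms equal to $1$; (b) every integer in the interval $[2\ell-S,S]$ equals the sum of some subsequence of $\alpha$ of length at least $2\ell-S$.
   Context: A subsequence of a sequence is obtained by choosing some of its terms (respecting multiplicities). -}

module Defs where

{-# OPTIONS --safe #-}

-- Split α into its k ones and the list γ of its other terms, each at least 2; then
-- 2ℓ - S = k + 2 length γ - sum γ ≤ k, which is (a).  For (b), run through γ and take a
-- term only when the later terms of γ together with all k ones can no longer reach n;
-- the rest of n is made up with ones.  The bound 2ℓ - S ≥ max 1 D, inherited by every
-- tail of γ, gives b ≤ k + 1 and b + D ≤ k + 2 for each term b, so a forced term never
-- overshoots n, and the remaining target n - b still has room for the D - 1 terms needed.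

module Submission where

open import Defs
open import Data.Nat using (ℕ; _+_; _*_; _∸_; _≤_; _<_; _≟_)
open import Data.List using (List; length; filter)
open import Data.Nat.ListAction using (sum)
open import Data.List.Relation.Unary.All using (All)
open import Data.List.Relation.Binary.Sublist.Propositional using (_⊆_)
open import Data.Product using (_×_; ∃-syntax)
open import Relation.Binary.PropositionalEquality using (_≡_)

open import Data.Bool using (true; false)
open import Data.Nat using (zero; suc; z≤n; s≤s; s≤s⁻¹; _≤?_)
open import Data.Nat.Properties
open import Data.Nat.ListAction.Properties using (sum-++; sum-↭)
open import Data.Nat.Tactic.RingSolver using (solve-∀)
open import Data.List using ([]; _∷_; _++_)
open import Data.List.Properties using (length-++)
open import Data.List.Relation.Unary.All using ([]; _∷_)
import Data.List.Relation.Unary.All as All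
open import Data.List.Relation.Unary.All.Properties using (all-filter; filter⁺)
open import Data.List.Relation.Binary.Sublist.Heterogeneous using ([]; _∷_; _∷ʳ_; minimum)
open import Data.List.Relation.Binary.Permutation.Propositional
  using (_↭_; ↭-refl; ↭-prep; ↭-sym; ↭-trans)
open import Data.List.Relation.Binary.Permutation.Propositional.Properties using (shift; ↭-length)
open import Data.Product using (_,_)
open import Function using (_∘_)
open import Relation.Binary.PropositionalEquality using (refl; sym; trans; cong; subst; module ≡-Reasoning)
open import Relation.Nullary using (yes; no; ¬?; does)
open import Relation.Unary using (Pred; Decidable)

module _ {a p} {A : Set a} {P : Pred A p} (P? : Decidable P) where

  ↭-filter-++-filter-¬ : (xs : List A) → xs ↭ filter P? xs ++ filter (¬? ∘ P?) xs
  ↭-filter-++-filter-¬ [] = ↭-refl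
  ↭-filter-++-filter-¬ (x ∷ xs) with does (P? x)
  ... | true = ↭-prep x (↭-filter-++-filter-¬ xs)
  ... | false = ↭-trans (↭-prep x (↭-filter-++-filter-¬ xs)) (↭-sym (shift x _ _))

  merge-filter-¬ : ∀ {xs ys zs} → ys ⊆ filter P? xs → zs ⊆ filter (¬? ∘ P?) xs →
                   ∃[ ws ] (ws ⊆ xs × ws ↭ ys ++ zs)
  merge-filter-¬ {[]} [] [] = [] , [] , ↭-refl
  merge-filter-¬ {x ∷ xs} ys⊆ zs⊆ with does (P? x)
  merge-filter-¬ {x ∷ xs} (_ ∷ʳ ys⊆) zs⊆ | true =
    let ws , ws⊆ , ws↭ = merge-filter-¬ ys⊆ zs⊆ in ws , x ∷ʳ ws⊆ , ws↭
  merge-filter-¬ {x ∷ xs} (refl ∷ ys⊆) zs⊆ | true =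
    let ws , ws⊆ , ws↭ = merge-filter-¬ ys⊆ zs⊆ in x ∷ ws , refl ∷ ws⊆ , ↭-prep x ws↭
  merge-filter-¬ {x ∷ xs} ys⊆ (_ ∷ʳ zs⊆) | false =
    let ws , ws⊆ , ws↭ = merge-filter-¬ ys⊆ zs⊆ in ws , x ∷ʳ ws⊆ , ws↭
  merge-filter-¬ {x ∷ xs} {ys} ys⊆ (refl ∷ zs⊆) | false =
    let ws , ws⊆ , ws↭ = merge-filter-¬ ys⊆ zs⊆
    in x ∷ ws , refl ∷ ws⊆ , ↭-trans (↭-prep x ws↭) (↭-sym (shift x ys _))

ones nonOnes : List ℕ → List ℕ
ones = filter (_≟ 1)
nonOnes = filter (¬? ∘ (_≟ 1))

All≡1⇒sum≡length : ∀ {xs} → All (_≡ 1) xs → sum xs ≡ length xs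
All≡1⇒sum≡length [] = refl
All≡1⇒sum≡length (refl ∷ ps) = cong suc (All≡1⇒sum≡length ps)

sublist-of-ones : ∀ {xs t} → All (_≡ 1) xs → t ≤ length xs →
                  ∃[ ys ] (ys ⊆ xs × sum ys ≡ t × length ys ≡ t)
sublist-of-ones {xs} {zero} _ _ = [] , minimum xs , refl , refl
sublist-of-ones {t = suc t} (refl ∷ ps) (s≤s t≤) =
  let ys , ys⊆ , sum≡ , length≡ = sublist-of-ones ps t≤
  in 1 ∷ ys , refl ∷ ys⊆ , cong suc sum≡ , cong suc length≡

length-ones+nonOnes : ∀ α → length α ≡ length (ones α) + length (nonOnes α)
length-ones+nonOnes α =
  trans (↭-length (↭-filter-++-filter-¬ (_≟ 1) α)) (length-++ (ones α))

sum-ones+nonOnes : ∀ α → sum α ≡ length (ones α) + sum (nonOnes α)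
sum-ones+nonOnes α = begin
  sum α                            ≡⟨ sum-↭ (↭-filter-++-filter-¬ (_≟ 1) α) ⟩
  sum (ones α ++ nonOnes α)        ≡⟨ sum-++ (ones α) (nonOnes α) ⟩
  sum (ones α) + sum (nonOnes α)   ≡⟨ cong (_+ sum (nonOnes α)) sum-ones≡length-ones ⟩
  length (ones α) + sum (nonOnes α) ∎
  where
  open ≡-Reasoning
  sum-ones≡length-ones : sum (ones α) ≡ length (ones α)
  sum-ones≡length-ones = All≡1⇒sum≡length (all-filter (_≟ 1) α)

insert-ones : ∀ α {β t} → β ⊆ nonOnes α → t ≤ length (ones α) →
              ∃[ μ ] (μ ⊆ α × sum μ ≡ sum β + t × length μ ≡ length β + t)
insert-ones α {β} {t} β⊆ t≤ =
  let δ , δ⊆ , sumδ , lengthδ = sublist-of-ones (all-filter (_≟ 1) α) t≤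
      μ , μ⊆ , μ↭ = merge-filter-¬ (_≟ 1) δ⊆ β⊆
  in μ , μ⊆ ,
     trans (sum-↭ μ↭) (trans (sum-++ δ β) (trans (cong (_+ sum β) sumδ) (+-comm t (sum β)))) ,
     trans (↭-length μ↭)
       (trans (length-++ δ) (trans (cong (_+ length β) lengthδ) (+-comm t (length β))))

nonOnes-≥2 : ∀ {α} → All (1 ≤_) α → All (2 ≤_) (nonOnes α)
nonOnes-≥2 {α} pos = All.zipWith (λ (1≤a , a≢1) → ≤∧≢⇒< 1≤a (a≢1 ∘ sym))
  (filter⁺ (¬? ∘ (_≟ 1)) pos , all-filter (¬? ∘ (_≟ 1)) α)

2*length≤sum : ∀ {γ} → All (2 ≤_) γ → 2 * length γ ≤ sum γ
2*length≤sum [] = z≤n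
2*length≤sum {b ∷ γ} (2≤b ∷ 2≤γ) = begin
  2 * suc (length γ)   ≡⟨ *-suc 2 (length γ) ⟩
  2 + 2 * length γ     ≤⟨ +-mono-≤ 2≤b (2*length≤sum 2≤γ) ⟩
  b + sum γ            ∎
  where open ≤-Reasoning

k+2*[1+m]≡2+k+2*m : ∀ k m → k + 2 * suc m ≡ 2 + k + 2 * m
k+2*[1+m]≡2+k+2*m = solve-∀

k+[x+y]≡x+[k+y] : ∀ k x y → k + (x + y) ≡ x + (k + y)
k+[x+y]≡x+[k+y] = solve-∀

2*[k+m]≡k+[k+2*m] : ∀ k m → 2 * (k + m) ≡ k + (k + 2 * m)
2*[k+m]≡k+[k+2*m] = solve-∀

-- `DeficitAtLeast x γ k` says x ≤ 2ℓ - S for the list γ extended by k ones.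
record DeficitAtLeast (x : ℕ) (γ : List ℕ) (k : ℕ) : Set where
  constructor deficit
  field x+sum≤k+2*length : x + sum γ ≤ k + 2 * length γ

deficit-mono : ∀ {x y γ k} → y ≤ x → DeficitAtLeast x γ k → DeficitAtLeast y γ k
deficit-mono {γ = γ} y≤x (deficit h) = deficit (≤-trans (+-monoˡ-≤ (sum γ) y≤x) h)

deficit-∷ : ∀ {x b γ k} → DeficitAtLeast x (b ∷ γ) k → DeficitAtLeast (x + b) γ (2 + k)
deficit-∷ {x} {b} {γ} {k} (deficit h) = deficit (begin
  x + b + sum γ             ≡⟨ +-assoc x b (sum γ) ⟩
  x + (b + sum γ)           ≤⟨ h ⟩
  k + 2 * suc (length γ)    ≡⟨ k+2*[1+m]≡2+k+2*m k (length γ) ⟩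
  2 + k + 2 * length γ      ∎)
  where open ≤-Reasoning

deficit-tail : ∀ {x b γ k} → 2 ≤ b → DeficitAtLeast x (b ∷ γ) k → DeficitAtLeast x γ k
deficit-tail {x} {b} {γ} {k} 2≤b d = deficit (+-cancelˡ-≤ 2 _ _ (begin
  2 + x + sum γ             ≡⟨ cong (_+ sum γ) (+-comm 2 x) ⟩
  x + 2 + sum γ             ≤⟨ +-monoˡ-≤ (sum γ) (+-monoʳ-≤ x 2≤b) ⟩
  x + b + sum γ             ≤⟨ DeficitAtLeast.x+sum≤k+2*length (deficit-∷ d) ⟩
  2 + k + 2 * length γ      ∎))
  where open ≤-Reasoning

deficit≤ones : ∀ {x γ k} → All (2 ≤_) γ → DeficitAtLeast x γ k → x ≤ k
deficit≤ones {x} {γ} {k} 2≤γ (deficit h) =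
  +-cancelʳ-≤ (2 * length γ) x k (≤-trans (+-monoʳ-≤ x (2*length≤sum 2≤γ)) h)

deficit-nonOnes : ∀ {x} α → x + sum α ≤ 2 * length α →
                  DeficitAtLeast x (nonOnes α) (length (ones α))
deficit-nonOnes {x} α h = deficit (+-cancelˡ-≤ k _ _ (begin
  k + (x + T)         ≡⟨ k+[x+y]≡x+[k+y] k x T ⟩
  x + (k + T)         ≡⟨ cong (x +_) (sum-ones+nonOnes α) ⟨
  x + sum α           ≤⟨ h ⟩
  2 * length α        ≡⟨ cong (2 *_) (length-ones+nonOnes α) ⟩
  2 * (k + m)         ≡⟨ 2*[k+m]≡k+[k+2*m] k m ⟩
  k + (k + 2 * m)     ∎))
  where
  open ≤-Reasoning
  k m T : ℕ
  k = length (ones α)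
  m = length (nonOnes α)
  T = sum (nonOnes α)

subsum-with-ones : ∀ {k γ} → All (2 ≤_) γ → DeficitAtLeast 1 γ k →
                   ∀ {D n} → D ≤ n → n ≤ k + sum γ → DeficitAtLeast D γ k →
                   ∃[ β ] ∃[ t ] (β ⊆ γ × t ≤ k × sum β + t ≡ n × D ≤ length β + t)
subsum-with-ones {k} [] _ {n = n} D≤n n≤k _ =
  [] , n , [] , ≤-trans n≤k (≤-reflexive (+-identityʳ k)) , refl , D≤n
subsum-with-ones {k} {b ∷ γ} (2≤b ∷ 2≤γ) deficit₁ {D} {n} D≤n n≤ deficitD
  with n ≤? k + sum γ
... | yes n≤rest =
  let β , t , β⊆ , t≤k , sum≡ , D≤ =
        subsum-with-ones 2≤γ (deficit-tail 2≤b deficit₁) D≤n n≤rest (deficit-tail 2≤b deficitD)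
  in β , t , b ∷ʳ β⊆ , t≤k , sum≡ , D≤
... | no n≰rest =
  let β , t , β⊆ , t≤k , sum≡ , D∸1≤ =
        subsum-with-ones 2≤γ (deficit-tail 2≤b deficit₁) D∸1≤n∸b n∸b≤rest
          (deficit-mono (m∸n≤m D 1) (deficit-tail 2≤b deficitD))
  in b ∷ β , t , refl ∷ β⊆ , t≤k ,
     trans (+-assoc b (sum β) t) (trans (cong (b +_) sum≡) (m+[n∸m]≡n b≤n)) ,
     ≤-trans (m≤n+m∸n D 1) (s≤s D∸1≤)
  where
  1+k≤n : suc k ≤ n
  1+k≤n = ≤-trans (s≤s (m≤m+n k (sum γ))) (≰⇒> n≰rest)
  b≤n : b ≤ n
  b≤n = ≤-trans (s≤s⁻¹ (deficit≤ones 2≤γ (deficit-∷ deficit₁))) 1+k≤n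
  D+b≤1+n : D + b ≤ suc n
  D+b≤1+n = ≤-trans (deficit≤ones 2≤γ (deficit-∷ deficitD)) (s≤s 1+k≤n)
  D∸1≤n∸b : D ∸ 1 ≤ n ∸ b
  D∸1≤n∸b = m≤n+o⇒m∸n≤o D 1
    (subst (D ≤_) (+-∸-assoc 1 b≤n) (m+n≤o⇒m≤o∸n D D+b≤1+n))
  n∸b≤rest : n ∸ b ≤ k + sum γ
  n∸b≤rest = m≤n+o⇒m∸n≤o n b (subst (n ≤_) (k+[x+y]≡x+[k+y] k b (sum γ)) n≤)

proposition2 : (α : List ℕ) → All (λ a → 1 ≤ a) α → sum α < 2 * length α →
    (2 * length α ∸ sum α ≤ length (filter (_≟ 1) α))
    × ((n : ℕ) → 2 * length α ∸ sum α ≤ n → n ≤ sum α →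
       ∃[ β ] (β ⊆ α × 2 * length α ∸ sum α ≤ length β × sum β ≡ n))
proposition2 α pos S<2ℓ = deficit≤ones 2≤γ (deficit-nonOnes α D+S≤2ℓ) , subsum
  where
  D : ℕ
  D = 2 * length α ∸ sum α
  D+S≤2ℓ : D + sum α ≤ 2 * length α
  D+S≤2ℓ = ≤-reflexive (m∸n+n≡m (<⇒≤ S<2ℓ))
  2≤γ : All (2 ≤_) (nonOnes α)
  2≤γ = nonOnes-≥2 pos
  subsum : (n : ℕ) → D ≤ n → n ≤ sum α → ∃[ β ] (β ⊆ α × D ≤ length β × sum β ≡ n)
  subsum n D≤n n≤S =
    let β , t , β⊆ , t≤k , sum≡ , D≤ =
          subsum-with-ones 2≤γ (deficit-nonOnes α S<2ℓ) D≤n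
            (subst (n ≤_) (sum-ones+nonOnes α) n≤S) (deficit-nonOnes α D+S≤2ℓ)
        μ , μ⊆ , sumμ , lengthμ = insert-ones α β⊆ t≤k
    in μ , μ⊆ , subst (D ≤_) (sym lengthμ) D≤ , trans sumμ sum≡
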